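{- Let $N\ge1$ and $0<\lambda<1$. There is a stable matching instance with men $m_1,\dots,m_N$ and $N$ women with the following properties. One woman $w$ has complete popularity preferences with $\mathcal D_w(m_i)$ proportional to $\lambda^i$. All other persons have fixed preference lists. In this instance, \[\mathbb E[\text{number of stable husbands of } w]>(1-\lambda)\cdot N .\]
   Context: Popularity preferences: $w$ assigns positive popularities $\mathcal D_w(m)$ (normalized to sum to $1$) to her acceptable men, here all men. She ranks them by successively drawing the next favourite, without replacement, with probability proportional to $\mathcal D_w$. A matching is stable if no man–woman pair prefer each other to their partners and no one is matched to an unacceptable partner. A stable husband of $w$ is a man matched to $w$ in some stable matching.
   Formalization: The parameter λ ranges only over the rationals strictly between 0 and 1. -}

module Defs where

open import Data.Nat as ℕ using (ℕ; zero; suc)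
open import Data.Nat.Properties as ℕP using ()
open import Data.Fin using (Fin; toℕ)
open import Data.Fin.Properties using (any?; all?) renaming (_≟_ to _≟ᶠ_)
open import Data.Maybe using (Maybe; just; nothing)
open import Data.Maybe.Properties using (≡-dec)
open import Data.Vec using (Vec; []; _∷_; lookup)
open import Data.List using (List; []; _∷_; map; concatMap; allFin; filter; length; foldr)
open import Data.List.Membership.Propositional using (_∈_)
import Data.List.Membership.DecPropositional as DecMem
open import Data.List.Relation.Unary.Unique.Propositional using (Unique)
open import Data.Product using (Σ; ∃; _×_; _,_; proj₁; proj₂)
open import Data.Sum using (inj₁; inj₂)
open import Data.Empty using (⊥)
open import Data.Integer using (+_)
open import Data.Rational as ℚ using (ℚ; 0ℚ; 1ℚ; _+_; _*_; _÷_)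
open import Data.Rational.Properties using () renaming (_≟_ to _≟ℚ_)
open import Relation.Binary.PropositionalEquality using (_≡_; refl)
open import Relation.Nullary using (¬_; Dec; yes; no)
open import Relation.Nullary.Decidable using (_×-dec_; _→-dec_; ¬?; map′)
open import Relation.Unary using (Decidable)

-- Preference lists.  A preference list of a person is a list of persons
-- of the other side, most preferred first; the persons occurring in it
-- are exactly the acceptable ones.

-- position of the first occurrence of a in L (length L if absent)
pos : ∀ {n} → Fin n → List (Fin n) → ℕ
pos a [] = 0
pos a (b ∷ L) with a ≟ᶠ b
... | yes _ = 0
... | no  _ = suc (pos a L)

Prefers : ∀ {n} → List (Fin n) → Fin n → Fin n → Set
Prefers L a b = a ∈ L × b ∈ L × pos a L ℕ.< pos b L

-- An instance with N men (Fin N, man i = m_{i+1}) and N women (Fin N).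
record Profile (N : ℕ) : Set where
  field
    manList   : Fin N → List (Fin N)   -- lists of women
    womanList : Fin N → List (Fin N)   -- lists of men
open Profile public

-- A (partial) matching: each man's partner, if any.
Matching : ℕ → Set
Matching N = Vec (Maybe (Fin N)) N

module _ {N : ℕ} (P : Profile N) (μ : Matching N) where

  IsMatching : Set
  IsMatching = ∀ m m' v → lookup μ m ≡ just v → lookup μ m' ≡ just v → m ≡ m'

  IndividuallyRational : Set
  IndividuallyRational = ∀ m v → lookup μ m ≡ just v → v ∈ manList P m × m ∈ womanList P v

  ManPrefersTo : Fin N → Fin N → Maybe (Fin N) → Set
  ManPrefersTo m v nothing   = v ∈ manList P m
  ManPrefersTo m v (just v') = Prefers (manList P m) v v'

  WomanPrefersTo : Fin N → Fin N → Set
  WomanPrefersTo v m = m ∈ womanList P v × (∀ m' → lookup μ m' ≡ just v → Prefers (womanList P v) m m')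

  BlockingPair : Fin N → Fin N → Set
  BlockingPair m v = ManPrefersTo m v (lookup μ m) × WomanPrefersTo v m

  Stable : Set
  Stable = IsMatching × IndividuallyRational × (∀ m v → ¬ BlockingPair m v)

StableHusband : ∀ {N} → Profile N → Fin N → Fin N → Set
StableHusband {N} P w m = Σ (Matching N) λ μ → Stable P μ × lookup μ m ≡ just w

private
  _∈?_ : ∀ {n} (a : Fin n) (L : List (Fin n)) → Dec (a ∈ L)
  _∈?_ {n} a L = DecMem._∈?_ (_≟ᶠ_ {n}) a L

  _≟ᵐ_ : ∀ {N} (x y : Maybe (Fin N)) → Dec (x ≡ y)
  _≟ᵐ_ = ≡-dec _≟ᶠ_

  prefers? : ∀ {n} L (a b : Fin n) → Dec (Prefers L a b)
  prefers? L a b = (a ∈? L) ×-dec ((b ∈? L) ×-dec (pos a L ℕP.<? pos b L))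

  anyMaybe? : ∀ {N} {Q : Maybe (Fin N) → Set} → Decidable Q → Dec (∃ Q)
  anyMaybe? {Q = Q} Q? with Q? nothing
  ... | yes q = yes (nothing , q)
  ... | no ¬q with any? (λ v → Q? (just v))
  ...   | yes (v , q) = yes (just v , q)
  ...   | no ¬r = no λ { (nothing , q) → ¬q q ; (just v , q) → ¬r (v , q) }

  anyVec? : ∀ {N} k {Q : Vec (Maybe (Fin N)) k → Set} → Decidable Q → Dec (∃ Q)
  anyVec? zero {Q} Q? with Q? []
  ... | yes q = yes ([] , q)
  ... | no ¬q = no λ { ([] , q) → ¬q q }
  anyVec? (suc k) {Q} Q? with anyMaybe? (λ x → anyVec? k (λ xs → Q? (x ∷ xs)))
  ... | yes (x , xs , q) = yes (x ∷ xs , q)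
  ... | no ¬r = no λ { (x ∷ xs , q) → ¬r (x , xs , q) }

  module _ {N : ℕ} (P : Profile N) (μ : Matching N) where
    manPrefersTo? : ∀ m v x → Dec (ManPrefersTo P μ m v x)
    manPrefersTo? m v nothing   = v ∈? manList P m
    manPrefersTo? m v (just v') = prefers? (manList P m) v v'

    stable? : Dec (Stable P μ)
    stable? =
      all? (λ m → all? (λ m' → all? (λ v →
        ((lookup μ m ≟ᵐ just v) →-dec ((lookup μ m' ≟ᵐ just v) →-dec (m ≟ᶠ m'))))))
      ×-dec
      (all? (λ m → all? (λ v →
        (lookup μ m ≟ᵐ just v) →-dec ((v ∈? manList P m) ×-dec (m ∈? womanList P v)))))
      ×-dec
      (all? (λ m → all? (λ v → ¬?
        (manPrefersTo? m v (lookup μ m) ×-dec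
          ((m ∈? womanList P v) ×-dec
            all? (λ m' → (lookup μ m' ≟ᵐ just v) →-dec prefers? (womanList P v) m m'))))))

stableHusband? : ∀ {N} (P : Profile N) (w : Fin N) → Decidable (StableHusband P w)
stableHusband? {N} P w m = anyVec? N (λ μ → stable? P μ ×-dec (lookup μ m ≟ᵐ just w))

numStableHusbands : ∀ {N} → Profile N → Fin N → ℕ
numStableHusbands {N} P w = length (filter (stableHusband? P w) (allFin N))

insertions : ∀ {A : Set} → A → List A → List (List A)
insertions x [] = (x ∷ []) ∷ []
insertions x (y ∷ ys) = (x ∷ y ∷ ys) ∷ map (y ∷_) (insertions x ys)

permutations : ∀ {A : Set} → List A → List (List A)
permutations [] = [] ∷ []
permutations (x ∷ xs) = concatMap (insertions x) (permutations xs)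

withList : ∀ {N} → Profile N → Fin N → List (Fin N) → Profile N
withList {N} P w π = record { manList = manList P ; womanList = wl }
  where
    wl : Fin N → List (Fin N)
    wl v with v ≟ᶠ w
    ... | yes _ = π
    ... | no  _ = womanList P v

-- division on ℚ, total (returns 0 on division by 0; never used with 0 below)
_÷₀_ : ℚ → ℚ → ℚ
p ÷₀ q with q ≟ℚ 0ℚ
... | yes _  = 0ℚ
... | no q≢0 = _÷_ p q {{ℚ.≢-nonZero q≢0}}

sumℚ : List ℚ → ℚ
sumℚ = foldr _+_ 0ℚ

_^ℚ_ : ℚ → ℕ → ℚ
x ^ℚ zero  = 1ℚ
x ^ℚ suc k = x * (x ^ℚ k)

popularity : (N : ℕ) → ℚ → Fin N → ℚ
popularity N λ' m = (λ' ^ℚ suc (toℕ m)) ÷₀ sumℚ (map (λ j → λ' ^ℚ suc (toℕ j)) (allFin N))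

-- probability of drawing the ranking π (listing all remaining candidates)
-- by successive draws without replacement proportional to D:
-- P(x ∷ π) = D x / (D x + Σ_{y ∈ π} D y) · P(π)
rankingProb : ∀ {N} → (Fin N → ℚ) → List (Fin N) → ℚ
rankingProb D [] = 1ℚ
rankingProb D (x ∷ π) = (D x ÷₀ sumℚ (map D (x ∷ π))) * rankingProb D π

expectedStableHusbands : ∀ {N} → Profile N → Fin N → (Fin N → ℚ) → ℚ
expectedStableHusbands {N} P w D =
  sumℚ (map (λ π → rankingProb D π * (+ numStableHusbands (withList P w π) w ℚ./ 1))
            (permutations (allFin N)))

{-# OPTIONS --safe #-}
module Submission where

-- Index the men 0, …, N−1 and let w be woman 0. Man j ranks woman j+1, then w, then woman j;
-- woman j ≠ w ranks man j, then man j−1. Call k a record of w's ranking π if every man she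
-- ranks above k has a smaller index. Then k is a stable husband of w: the men below k move up
-- to their next woman, k marries w, and the men above k keep their own woman. So it suffices to
-- bound the expected number of records. A ranking of a list arises by inserting its first man
-- into a ranking of the rest; when he has the smallest index, this adds a record exactly when
-- he is put first. Hence the expected number of records is Σₓ D x / (D x + Σ_{y > x} D y),
-- and for geometric popularities D (x+1) = λ D x each term exceeds 1 − λ.

open import Defs
open import Data.Nat as ℕ using (ℕ; zero; suc; _≤_; s≤s; z≤n)
import Data.Nat.Properties as ℕ
import Data.Nat.Coprimality as Coprime
open import Data.Integer using (+_)
import Data.Integer as ℤ
import Data.Integer.Properties as ℤ
open import Data.Rational using (ℚ; 0ℚ; 1ℚ; _<_; _-_; _+_; _*_; _/_; 1/_)
  renaming (_≤_ to _≤ℚ_)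
open import Data.Rational.Base using (>-nonZero; positive; nonNegative)
open import Data.Rational.Properties
open import Data.Rational.Solver using (module +-*-Solver)
open import Data.Fin using (Fin; toℕ; zero; suc; fromℕ<; inject₁)
open import Data.Fin.Properties using (toℕ-injective; toℕ<n; toℕ-fromℕ<; toℕ-inject₁)
  renaming (_≟_ to _≟ᶠ_)
open import Data.Maybe using (just)
open import Data.Maybe.Properties using (just-injective)
open import Data.Vec as Vec using (lookup)
open import Data.Vec.Properties using (lookup∘tabulate)
import Data.List
open import Data.List using (List; []; _∷_; _++_; map; concatMap; length; allFin; filter)
open import Data.List.Properties using (map-++; map-∘; ++-assoc; filter-all; length-tabulate)
open import Data.List.Membership.Propositional using (_∈_)
open import Data.List.Membership.Propositional.Properties
  using (∈-map⁻; ∈-concat⁻′; ∈-++⁺ʳ; ∈-++⁻; ∈-allFin)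
open import Data.List.Relation.Unary.Any using (here; there)
open import Data.List.Relation.Unary.All as All using (All; []; _∷_)
open import Data.List.Relation.Unary.AllPairs using (AllPairs; []; _∷_)
import Data.List.Relation.Unary.AllPairs.Properties as AllPairs
open import Data.List.Relation.Unary.Unique.Propositional using (Unique)
open import Data.List.Relation.Binary.Permutation.Propositional
  using (_↭_; ↭-refl; ↭-prep; ↭-swap; ↭-trans; ↭-sym; ↭⇒↭ₛ)
open import Data.List.Relation.Binary.Permutation.Propositional.Properties
  using (map⁺; All-resp-↭; ∈-resp-↭; filter-↭; ↭-length)
import Data.List.Relation.Binary.Permutation.Setoid.Properties as ↭ₛ
open import Data.List.Relation.Binary.Sublist.Propositional using (_⊆_; []; _∷_; _∷ʳ_)
open import Data.List.Relation.Binary.Sublist.Propositional.Properties using (filter⁺; length-mono-≤)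
open import Data.Product using (Σ; ∃; ∃₂; _×_; _,_; proj₂)
open import Data.Sum using (_⊎_; inj₁; inj₂)
open import Function using (_∘_; id)
open import Relation.Binary.Definitions using (tri<; tri≈; tri>)
open import Relation.Binary.PropositionalEquality
open import Relation.Nullary using (yes; no; ¬_)
open import Relation.Nullary.Negation using (contradiction)
open +-*-Solver

sumℚ-++ : (xs ys : List ℚ) → sumℚ (xs ++ ys) ≡ sumℚ xs + sumℚ ys
sumℚ-++ [] ys = sym (+-identityˡ _)
sumℚ-++ (x ∷ xs) ys = trans (cong (_+_ x) (sumℚ-++ xs ys)) (sym (+-assoc x _ _))

module _ {A : Set} where

  sumℚ-cong : {f g : A → ℚ} (l : List A) → (∀ a → a ∈ l → f a ≡ g a) →
    sumℚ (map f l) ≡ sumℚ (map g l)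
  sumℚ-cong [] _ = refl
  sumℚ-cong (a ∷ l) f≡g = cong₂ _+_ (f≡g a (here refl)) (sumℚ-cong l (λ b b∈ → f≡g b (there b∈)))

  sumℚ-concatMap : {B : Set} (f : B → ℚ) (g : A → List B) (l : List A) →
    sumℚ (map f (concatMap g l)) ≡ sumℚ (map (λ a → sumℚ (map f (g a))) l)
  sumℚ-concatMap f g [] = refl
  sumℚ-concatMap f g (a ∷ l) = begin
    sumℚ (map f (g a ++ concatMap g l))
      ≡⟨ cong sumℚ (map-++ f (g a) _) ⟩
    sumℚ (map f (g a) ++ map f (concatMap g l))
      ≡⟨ sumℚ-++ (map f (g a)) _ ⟩
    sumℚ (map f (g a)) + sumℚ (map f (concatMap g l))
      ≡⟨ cong (_+_ (sumℚ (map f (g a)))) (sumℚ-concatMap f g l) ⟩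
    sumℚ (map f (g a)) + sumℚ (map (λ a → sumℚ (map f (g a))) l) ∎
    where open ≡-Reasoning

  sumℚ-*ˡ : (c : ℚ) (f : A → ℚ) (l : List A) → sumℚ (map (λ a → c * f a) l) ≡ c * sumℚ (map f l)
  sumℚ-*ˡ c f [] = sym (*-zeroʳ c)
  sumℚ-*ˡ c f (a ∷ l) =
    trans (cong (_+_ (c * f a)) (sumℚ-*ˡ c f l)) (sym (*-distribˡ-+ c (f a) (sumℚ (map f l))))

  sumℚ-*ʳ : (c : ℚ) (f : A → ℚ) (l : List A) → sumℚ (map (λ a → f a * c) l) ≡ sumℚ (map f l) * c
  sumℚ-*ʳ c f [] = sym (*-zeroˡ c)
  sumℚ-*ʳ c f (a ∷ l) =
    trans (cong (_+_ (f a * c)) (sumℚ-*ʳ c f l)) (sym (*-distribʳ-+ c (f a) (sumℚ (map f l))))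

  sumℚ-+ : (f g : A → ℚ) (l : List A) →
    sumℚ (map (λ a → f a + g a) l) ≡ sumℚ (map f l) + sumℚ (map g l)
  sumℚ-+ f g [] = refl
  sumℚ-+ f g (a ∷ l) = begin
    (f a + g a) + sumℚ (map (λ a → f a + g a) l)
      ≡⟨ cong (_+_ (f a + g a)) (sumℚ-+ f g l) ⟩
    (f a + g a) + (F + G)
      ≡⟨ solve 4 (λ a b F G → (a :+ b) :+ (F :+ G) := (a :+ F) :+ (b :+ G)) refl (f a) (g a) F G ⟩
    (f a + F) + (g a + G) ∎
    where
    open ≡-Reasoning
    F = sumℚ (map f l)
    G = sumℚ (map g l)

  sumℚ-mono-≤ : {f g : A → ℚ} (l : List A) → (∀ a → a ∈ l → f a ≤ℚ g a) →
    sumℚ (map f l) ≤ℚ sumℚ (map g l)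
  sumℚ-mono-≤ [] _ = ≤-refl
  sumℚ-mono-≤ (a ∷ l) f≤g =
    +-mono-≤ (f≤g a (here refl)) (sumℚ-mono-≤ l (λ b b∈ → f≤g b (there b∈)))

  sumℚ-nonNeg : {f : A → ℚ} (l : List A) → (∀ a → 0ℚ ≤ℚ f a) → 0ℚ ≤ℚ sumℚ (map f l)
  sumℚ-nonNeg {f} l f≥0 = subst (_≤ℚ sumℚ (map f l)) (sumℚ-zero l) (sumℚ-mono-≤ l (λ a _ → f≥0 a))
    where
    sumℚ-zero : (l : List A) → sumℚ (map (λ _ → 0ℚ) l) ≡ 0ℚ
    sumℚ-zero [] = refl
    sumℚ-zero (_ ∷ l) = trans (+-identityˡ (sumℚ (map (λ _ → 0ℚ) l))) (sumℚ-zero l)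

  sumℚ-↭ : (f : A → ℚ) {xs ys : List A} → xs ↭ ys → sumℚ (map f xs) ≡ sumℚ (map f ys)
  sumℚ-↭ f p = ↭ₛ.foldr-commMonoid (setoid ℚ) +-0-isCommutativeMonoid (↭⇒↭ₛ (map⁺ f p))

  insertions-↭ : ∀ (x : A) σ {τ} → τ ∈ insertions x σ → τ ↭ x ∷ σ
  insertions-↭ x [] (here refl) = ↭-refl
  insertions-↭ x (y ∷ σ) (here refl) = ↭-refl
  insertions-↭ x (y ∷ σ) (there τ∈) with ∈-map⁻ (y ∷_) τ∈
  ... | τ′ , τ′∈ , refl = ↭-trans (↭-prep y (insertions-↭ x σ τ′∈)) (↭-swap y x ↭-refl)

  ∈-permutations⁻ : ∀ (x : A) xs {π} → π ∈ permutations (x ∷ xs) →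
    ∃ λ σ → σ ∈ permutations xs × π ∈ insertions x σ
  ∈-permutations⁻ x xs π∈ with ∈-concat⁻′ (map (insertions x) (permutations xs)) π∈
  ... | τs , π∈τs , τs∈ with ∈-map⁻ (insertions x) τs∈
  ...   | σ , σ∈ , refl = σ , σ∈ , π∈τs

  permutations-↭ : ∀ (L : List A) {π} → π ∈ permutations L → π ↭ L
  permutations-↭ [] (here refl) = ↭-refl
  permutations-↭ (x ∷ xs) π∈ with ∈-permutations⁻ x xs π∈
  ... | σ , σ∈ , π∈ = ↭-trans (insertions-↭ x σ π∈) (↭-prep x (permutations-↭ xs σ∈))

module _ {q : ℚ} (q>0 : 0ℚ < q) where

  private
    q⁻¹ : ℚ
    q⁻¹ = (1/ q) {{>-nonZero q>0}}

    q*q⁻¹≡1 : q * q⁻¹ ≡ 1ℚ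
    q*q⁻¹≡1 = *-inverseʳ q {{>-nonZero q>0}}

    q⁻¹>0 : 0ℚ < q⁻¹
    q⁻¹>0 = positive⁻¹ q⁻¹ {{1/pos⇒pos q {{positive q>0}}}}

  ÷₀-as-* : ∀ p → p ÷₀ q ≡ p * q⁻¹
  ÷₀-as-* p with q ≟ 0ℚ
  ... | yes q≡0 = contradiction (subst (0ℚ <_) q≡0 q>0) (<-irrefl refl)
  ... | no _    = refl

  ÷₀-nonNeg : ∀ {p} → 0ℚ ≤ℚ p → 0ℚ ≤ℚ p ÷₀ q
  ÷₀-nonNeg {p} p≥0 = subst (0ℚ ≤ℚ_) (sym (÷₀-as-* p))
    (nonNegative⁻¹ _ {{nonNeg*nonNeg⇒nonNeg p {{nonNegative p≥0}} q⁻¹ {{nonNegative (<⇒≤ q⁻¹>0)}}}})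

  ÷₀-pos : ∀ {p} → 0ℚ < p → 0ℚ < p ÷₀ q
  ÷₀-pos {p} p>0 = subst (0ℚ <_) (sym (÷₀-as-* p))
    (positive⁻¹ _ {{pos*pos⇒pos p {{positive p>0}} q⁻¹ {{positive q⁻¹>0}}}})

  ÷₀-self : q ÷₀ q ≡ 1ℚ
  ÷₀-self = trans (÷₀-as-* q) q*q⁻¹≡1

  ÷₀-*ˡ : ∀ c p → (c * p) ÷₀ q ≡ c * (p ÷₀ q)
  ÷₀-*ˡ c p = trans (÷₀-as-* (c * p)) (trans (*-assoc c p q⁻¹) (cong (c *_) (sym (÷₀-as-* p))))

  *<⇒<÷₀ : ∀ {c p} → c * q < p → c < p ÷₀ q
  *<⇒<÷₀ {c} {p} cq<p = subst₂ _<_ c*q*q⁻¹≡c (sym (÷₀-as-* p))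
    (*-monoˡ-<-pos q⁻¹ {{positive q⁻¹>0}} cq<p)
    where
    c*q*q⁻¹≡c : c * q * q⁻¹ ≡ c
    c*q*q⁻¹≡c = trans (*-assoc c q q⁻¹) (trans (cong (c *_) q*q⁻¹≡1) (*-identityʳ c))

-- Total probability, with s the weight of a set S ∋ b: b precedes the rest of S
-- either by being drawn first from {a} ∪ S, or after a is.
÷₀-total-probability : ∀ a b {s} → 0ℚ < s → 0ℚ < a + s →
  (a ÷₀ (a + s)) * (b ÷₀ s) + b ÷₀ (a + s) ≡ b ÷₀ s
÷₀-total-probability a b {s} s>0 a+s>0 = begin
  (a ÷₀ (a + s)) * (b ÷₀ s) + b ÷₀ (a + s)
    ≡⟨ cong₂ (λ u v → u * v + b ÷₀ (a + s)) (÷₀-as-* a+s>0 a) (÷₀-as-* s>0 b) ⟩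
  a * i * (b * j) + b ÷₀ (a + s)
    ≡⟨ cong (_+_ (a * i * (b * j))) (÷₀-as-* a+s>0 b) ⟩
  a * i * (b * j) + b * i
    ≡⟨ cong (_+_ (a * i * (b * j))) (sym (trans (cong (b * i *_) s*j≡1) (*-identityʳ (b * i)))) ⟩
  a * i * (b * j) + b * i * (s * j)
    ≡⟨ solve 5 (λ a b s i j → a :* i :* (b :* j) :+ b :* i :* (s :* j) := b :* j :* ((a :+ s) :* i))
         refl a b s i j ⟩
  b * j * ((a + s) * i)
    ≡⟨ trans (cong (b * j *_) (*-inverseʳ (a + s) {{>-nonZero a+s>0}})) (*-identityʳ (b * j)) ⟩
  b * j
    ≡⟨ sym (÷₀-as-* s>0 b) ⟩
  b ÷₀ s ∎
  where
  open ≡-Reasoning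
  i = (1/ (a + s)) {{>-nonZero a+s>0}}
  j = (1/ s) {{>-nonZero s>0}}
  s*j≡1 : s * j ≡ 1ℚ
  s*j≡1 = *-inverseʳ s {{>-nonZero s>0}}

module _ {n : ℕ} where

  pos-++-∷ : ∀ {b : Fin n} A B → ¬ b ∈ A → pos b (A ++ b ∷ B) ≡ length A
  pos-++-∷ {b} [] B _ with b ≟ᶠ b
  ... | yes _   = refl
  ... | no  b≢b = contradiction refl b≢b
  pos-++-∷ {b} (a ∷ A) B b∉a∷A with b ≟ᶠ a
  ... | yes refl = contradiction (here refl) b∉a∷A
  ... | no  _    = cong suc (pos-++-∷ A B (b∉a∷A ∘ there))

  pos<length⇒∈ : ∀ {a : Fin n} A R → pos a (A ++ R) ℕ.< length A → a ∈ A
  pos<length⇒∈ {a} (b ∷ A) R pos<len with a ≟ᶠ b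
  ... | yes refl = here refl
  ... | no  _    = there (pos<length⇒∈ A R (ℕ.s≤s⁻¹ pos<len))

  Prefers-++-∷⇒∈ : ∀ {a b : Fin n} A B → ¬ b ∈ A → Prefers (A ++ b ∷ B) a b → a ∈ A
  Prefers-++-∷⇒∈ {a} A B b∉A (_ , _ , a<b) =
    pos<length⇒∈ A _ (subst (pos a (A ++ _ ∷ B) ℕ.<_) (pos-++-∷ A B b∉A) a<b)

  ¬Prefers-over-head : ∀ {a b : Fin n} B → ¬ Prefers (b ∷ B) a b
  ¬Prefers-over-head B a≻b with Prefers-++-∷⇒∈ [] B (λ ()) a≻b
  ... | ()

module _ {N : ℕ} where

  -- The left-to-right maxima of π that are at least t.
  records : ℕ → List (Fin N) → List (Fin N)
  records t [] = []
  records t (y ∷ ys) with t ℕ.≤? toℕ y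
  ... | yes _ = y ∷ records (suc (toℕ y)) ys
  ... | no  _ = records t ys

  #records : List (Fin N) → ℕ
  #records π = length (records 0 π)

  records-accept : ∀ {t} y ys → t ≤ toℕ y → records t (y ∷ ys) ≡ y ∷ records (suc (toℕ y)) ys
  records-accept {t} y ys t≤y with t ℕ.≤? toℕ y
  ... | yes _   = refl
  ... | no  t≰y = contradiction t≤y t≰y

  records-reject : ∀ {t} y ys → ¬ t ≤ toℕ y → records t (y ∷ ys) ≡ records t ys
  records-reject {t} y ys t≰y with t ℕ.≤? toℕ y
  ... | yes t≤y = contradiction t≤y t≰y
  ... | no  _   = refl

  records-⊆ : ∀ t π → records t π ⊆ π
  records-⊆ t [] = []
  records-⊆ t (y ∷ ys) with t ℕ.≤? toℕ y
  ... | yes _ = refl ∷ records-⊆ (suc (toℕ y)) ys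
  ... | no  _ = y ∷ʳ records-⊆ t ys

  records-above : ∀ (x : Fin N) σ → All (λ y → toℕ x ℕ.< toℕ y) σ →
    records (suc (toℕ x)) σ ≡ records 0 σ
  records-above x [] [] = refl
  records-above x (y ∷ σ) (x<y ∷ _) = trans (records-accept y σ x<y) (sym (records-accept y σ ℕ.z≤n))

  length-records-insertions : ∀ {t} x σ {τ} → toℕ x ℕ.< t → τ ∈ insertions x σ →
    length (records t τ) ≡ length (records t σ)
  length-records-insertions x [] x<t (here refl) =
    cong length (records-reject x [] (ℕ.<⇒≱ x<t))
  length-records-insertions x (y ∷ σ) x<t (here refl) =
    cong length (records-reject x (y ∷ σ) (ℕ.<⇒≱ x<t))
  length-records-insertions {t} x (y ∷ σ) x<t (there τ∈) with ∈-map⁻ (y ∷_) τ∈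
  ... | τ′ , τ′∈ , refl with t ℕ.≤? toℕ y
  ...   | yes t≤y = cong suc (length-records-insertions x σ (ℕ.m<n⇒m<1+n (ℕ.<-≤-trans x<t t≤y)) τ′∈)
  ...   | no  _   = length-records-insertions x σ x<t τ′∈

  IsRecord : List (Fin N) → Fin N → Set
  IsRecord π k = ∃₂ λ A B → π ≡ A ++ k ∷ B × All (λ j → toℕ j ℕ.< toℕ k) A

  ∈-records⇒IsRecord : ∀ {t} π {k} → k ∈ records t π → t ≤ toℕ k × IsRecord π k
  ∈-records⇒IsRecord {t} (y ∷ ys) k∈ with t ℕ.≤? toℕ y
  ∈-records⇒IsRecord (y ∷ ys) (here refl) | yes t≤y = t≤y , [] , ys , refl , []
  ∈-records⇒IsRecord (y ∷ ys) (there k∈) | yes t≤y with ∈-records⇒IsRecord ys k∈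
  ... | y<k , A , B , refl , A<k = ℕ.≤-trans t≤y (ℕ.<⇒≤ y<k) , y ∷ A , B , refl , y<k ∷ A<k
  ∈-records⇒IsRecord (y ∷ ys) k∈ | no t≰y with ∈-records⇒IsRecord ys k∈
  ... | t≤k , A , B , refl , A<k = t≤k , y ∷ A , B , refl , ℕ.<-≤-trans (ℕ.≰⇒> t≰y) t≤k ∷ A<k

  Prefers-record⇒< : ∀ {π m k} → IsRecord π k → Prefers π m k → toℕ m ℕ.< toℕ k
  Prefers-record⇒< {k = k} (A , B , refl , A<k) m≻k = All.lookup A<k (Prefers-++-∷⇒∈ A B k∉A m≻k)
    where
    k∉A : ¬ k ∈ A
    k∉A k∈A = ℕ.<-irrefl refl (All.lookup A<k k∈A)

  Increasing : List (Fin N) → Set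
  Increasing = AllPairs (λ a b → toℕ a ℕ.< toℕ b)

  #records-∷-min : ∀ x σ → All (λ y → toℕ x ℕ.< toℕ y) σ → #records (x ∷ σ) ≡ suc (#records σ)
  #records-∷-min x σ x<σ =
    cong length (trans (records-accept x σ ℕ.z≤n) (cong (x ∷_) (records-above x σ x<σ)))

  #records-insertions-after : ∀ {x y} σ {τ} → toℕ x ℕ.< toℕ y → τ ∈ insertions x σ →
    #records (y ∷ τ) ≡ #records (y ∷ σ)
  #records-insertions-after {x} {y} σ {τ} x<y τ∈ = begin
    length (records 0 (y ∷ τ))
      ≡⟨ cong length (records-accept y τ ℕ.z≤n) ⟩
    suc (length (records (suc (toℕ y)) τ))
      ≡⟨ cong suc (length-records-insertions x σ (ℕ.m<n⇒m<1+n x<y) τ∈) ⟩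
    suc (length (records (suc (toℕ y)) σ))
      ≡⟨ cong length (records-accept y σ ℕ.z≤n) ⟨
    length (records 0 (y ∷ σ)) ∎
    where open ≡-Reasoning

ι : ℕ → ℚ
ι n = + n / 1

ι-suc : ∀ n → ι (suc n) ≡ 1ℚ + ι n
ι-suc n = trans (/-cong {p₂ = + 1 ℤ.* + 1 ℤ.+ + n ℤ.* + 1} {q₂ = 1 ℕ.* 1} n+1≡ refl)
                (cong (_+_ 1ℚ) (sym (normalize-coprime (Coprime.sym (Coprime.1-coprimeTo n)))))
  where
  n+1≡ : + suc n ≡ + 1 ℤ.* + 1 ℤ.+ + n ℤ.* + 1
  n+1≡ = cong (ℤ._+_ (+ 1)) (sym (ℤ.*-identityʳ (+ n)))

ι-mono-≤ : ∀ {m n} → m ≤ n → ι m ≤ℚ ι n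
ι-mono-≤ = mono′ ∘ ℕ.≤⇒≤′
  where
  mono′ : ∀ {m n} → m ℕ.≤′ n → ι m ≤ℚ ι n
  mono′ ℕ.≤′-refl = ≤-refl
  mono′ {n = suc n} (ℕ.≤′-step m≤′n) = ≤-trans (mono′ m≤′n) (subst (ι n ≤ℚ_) (sym (ι-suc n))
    (subst (_≤ℚ 1ℚ + ι n) (+-identityˡ (ι n)) (+-monoˡ-≤ (ι n) (nonNegative⁻¹ 1ℚ))))

module RankingProbability {N : ℕ} (D : Fin N → ℚ) (D>0 : ∀ x → 0ℚ < D x) where

  weight : List (Fin N) → ℚ
  weight l = sumℚ (map D l)

  firstProb : Fin N → List (Fin N) → ℚ
  firstProb x xs = D x ÷₀ (D x + weight xs)

  prob : List (Fin N) → ℚ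
  prob = rankingProb D

  weight-nonNeg : ∀ l → 0ℚ ≤ℚ weight l
  weight-nonNeg l = sumℚ-nonNeg l (λ x → <⇒≤ (D>0 x))

  weight-∷-pos : ∀ x l → 0ℚ < D x + weight l
  weight-∷-pos x l = subst (_< D x + weight l) (+-identityʳ 0ℚ) (+-mono-<-≤ (D>0 x) (weight-nonNeg l))

  prob-nonNeg : ∀ π → 0ℚ ≤ℚ prob π
  prob-nonNeg [] = nonNegative⁻¹ 1ℚ
  prob-nonNeg (x ∷ π) = nonNegative⁻¹ (prob (x ∷ π))
    {{nonNeg*nonNeg⇒nonNeg (firstProb x π) {{nonNegative (÷₀-nonNeg (weight-∷-pos x π) (<⇒≤ (D>0 x)))}}
                           (prob π) {{nonNegative (prob-nonNeg π)}}}}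

  sum-prob-insertions : ∀ x σ → sumℚ (map prob (insertions x σ)) ≡ prob σ
  sum-prob-insertions x [] = begin
    D x ÷₀ (D x + 0ℚ) * 1ℚ + 0ℚ       ≡⟨ trans (+-identityʳ _) (*-identityʳ _) ⟩
    D x ÷₀ (D x + 0ℚ)                 ≡⟨ cong (_÷₀ (D x + 0ℚ)) (+-identityʳ (D x)) ⟨
    (D x + 0ℚ) ÷₀ (D x + 0ℚ)          ≡⟨ ÷₀-self (weight-∷-pos x []) ⟩
    1ℚ                                ∎
    where open ≡-Reasoning
  sum-prob-insertions x (y ∷ σ) = begin
    prob (x ∷ y ∷ σ) + sumℚ (map prob (map (y ∷_) (insertions x σ)))
      ≡⟨ cong (_+_ (prob (x ∷ y ∷ σ))) (sym (cong sumℚ (map-∘ (insertions x σ)))) ⟩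
    prob (x ∷ y ∷ σ) + sumℚ (map (λ τ → firstProb y τ * prob τ) (insertions x σ))
      ≡⟨ cong (_+_ (prob (x ∷ y ∷ σ))) (sumℚ-cong (insertions x σ) (λ τ τ∈ →
           cong (λ w → D y ÷₀ w * prob τ)
             (sumℚ-↭ D (↭-trans (↭-prep y (insertions-↭ x σ τ∈)) (↭-swap y x ↭-refl))))) ⟩
    prob (x ∷ y ∷ σ) + sumℚ (map (λ τ → D y ÷₀ W * prob τ) (insertions x σ))
      ≡⟨ cong (_+_ (prob (x ∷ y ∷ σ))) (sumℚ-*ˡ (D y ÷₀ W) prob (insertions x σ)) ⟩
    D x ÷₀ W * (firstProb y σ * prob σ) + D y ÷₀ W * sumℚ (map prob (insertions x σ))
      ≡⟨ cong (λ p → D x ÷₀ W * (firstProb y σ * prob σ) + D y ÷₀ W * p) (sum-prob-insertions x σ) ⟩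
    D x ÷₀ W * (firstProb y σ * prob σ) + D y ÷₀ W * prob σ
      ≡⟨ solve 4 (λ a b c p → a :* (b :* p) :+ c :* p := (a :* b :+ c) :* p)
           refl (D x ÷₀ W) (firstProb y σ) (D y ÷₀ W) (prob σ) ⟩
    (D x ÷₀ W * firstProb y σ + D y ÷₀ W) * prob σ
      ≡⟨ cong (_* prob σ) (÷₀-total-probability (D x) (D y) (weight-∷-pos y σ) (weight-∷-pos x (y ∷ σ))) ⟩
    prob (y ∷ σ) ∎
    where
    open ≡-Reasoning
    W = weight (x ∷ y ∷ σ)

  sum-prob-permutations : ∀ L → sumℚ (map prob (permutations L)) ≡ 1ℚ
  sum-prob-permutations [] = +-identityʳ 1ℚ
  sum-prob-permutations (x ∷ xs) = begin
    sumℚ (map prob (concatMap (insertions x) (permutations xs)))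
      ≡⟨ sumℚ-concatMap prob (insertions x) (permutations xs) ⟩
    sumℚ (map (λ σ → sumℚ (map prob (insertions x σ))) (permutations xs))
      ≡⟨ sumℚ-cong (permutations xs) (λ σ _ → sum-prob-insertions x σ) ⟩
    sumℚ (map prob (permutations xs))
      ≡⟨ sum-prob-permutations xs ⟩
    1ℚ ∎
    where open ≡-Reasoning

  firstProbSum : List (Fin N) → ℚ
  firstProbSum [] = 0ℚ
  firstProbSum (x ∷ xs) = firstProb x xs + firstProbSum xs

  sum-prob-#records-insertions : ∀ x σ → All (λ y → toℕ x ℕ.< toℕ y) σ →
    sumℚ (map (λ τ → prob τ * ι (#records τ)) (insertions x σ))
      ≡ prob σ * ι (#records σ) + prob (x ∷ σ)
  sum-prob-#records-insertions x [] [] =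
    solve 1 (λ p → p :* con 1ℚ :+ con 0ℚ := con 1ℚ :* con 0ℚ :+ p) refl (prob (x ∷ []))
  sum-prob-#records-insertions x (y ∷ σ) x<y∷σ@(x<y ∷ _) = begin
    A * ι (#records (x ∷ y ∷ σ)) + sumℚ (map (λ τ → prob τ * ι (#records τ)) later)
      ≡⟨ cong₂ (λ u v → A * u + v) (trans (cong ι (#records-∷-min x (y ∷ σ) x<y∷σ)) (ι-suc r))
           (sumℚ-cong later (λ τ τ∈ → later-#records τ τ∈)) ⟩
    A * (1ℚ + ι r) + sumℚ (map (λ τ → prob τ * ι r) later)
      ≡⟨ cong (_+_ (A * (1ℚ + ι r))) (sumℚ-*ʳ (ι r) prob later) ⟩
    A * (1ℚ + ι r) + sumℚ (map prob later) * ι r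
      ≡⟨ solve 3 (λ a b ρ → a :* (con 1ℚ :+ ρ) :+ b :* ρ := (a :+ b) :* ρ :+ a)
           refl A (sumℚ (map prob later)) (ι r) ⟩
    (A + sumℚ (map prob later)) * ι r + A
      ≡⟨ cong (λ p → p * ι r + A) (sum-prob-insertions x (y ∷ σ)) ⟩
    prob (y ∷ σ) * ι r + A ∎
    where
    open ≡-Reasoning
    A = prob (x ∷ y ∷ σ)
    r = #records (y ∷ σ)
    later = map (y ∷_) (insertions x σ)
    later-#records : ∀ τ → τ ∈ later → prob τ * ι (#records τ) ≡ prob τ * ι r
    later-#records τ τ∈ with ∈-map⁻ (y ∷_) τ∈
    ... | τ′ , τ′∈ , refl = cong (λ c → prob (y ∷ τ′) * ι c) (#records-insertions-after σ x<y τ′∈)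

  expected-#records : ∀ L → Increasing L →
    sumℚ (map (λ π → prob π * ι (#records π)) (permutations L)) ≡ firstProbSum L
  expected-#records [] [] = refl
  expected-#records (x ∷ xs) (x<xs ∷ xs↑) = begin
    sumℚ (map (λ π → prob π * ι (#records π)) (concatMap (insertions x) (permutations xs)))
      ≡⟨ sumℚ-concatMap (λ π → prob π * ι (#records π)) (insertions x) (permutations xs) ⟩
    sumℚ (map (λ σ → sumℚ (map (λ τ → prob τ * ι (#records τ)) (insertions x σ))) (permutations xs))
      ≡⟨ sumℚ-cong (permutations xs) (λ σ σ∈ →
           sum-prob-#records-insertions x σ (All-resp-↭ (↭-sym (permutations-↭ xs σ∈)) x<xs)) ⟩
    sumℚ (map (λ σ → prob σ * ι (#records σ) + prob (x ∷ σ)) (permutations xs))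
      ≡⟨ sumℚ-+ (λ σ → prob σ * ι (#records σ)) (λ σ → prob (x ∷ σ)) (permutations xs) ⟩
    sumℚ (map (λ σ → prob σ * ι (#records σ)) (permutations xs))
      + sumℚ (map (λ σ → prob (x ∷ σ)) (permutations xs))
      ≡⟨ cong₂ _+_ (expected-#records xs xs↑) (sumℚ-cong (permutations xs) (λ σ σ∈ →
           cong (λ w → D x ÷₀ (D x + w) * prob σ) (sumℚ-↭ D (permutations-↭ xs σ∈)))) ⟩
    firstProbSum xs + sumℚ (map (λ σ → firstProb x xs * prob σ) (permutations xs))
      ≡⟨ cong (_+_ (firstProbSum xs)) (sumℚ-*ˡ (firstProb x xs) prob (permutations xs)) ⟩
    firstProbSum xs + firstProb x xs * sumℚ (map prob (permutations xs))
      ≡⟨ cong (λ p → firstProbSum xs + firstProb x xs * p) (sum-prob-permutations xs) ⟩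
    firstProbSum xs + firstProb x xs * 1ℚ
      ≡⟨ cong (_+_ (firstProbSum xs)) (*-identityʳ (firstProb x xs)) ⟩
    firstProbSum xs + firstProb x xs
      ≡⟨ +-comm (firstProbSum xs) (firstProb x xs) ⟩
    firstProbSum (x ∷ xs) ∎
    where open ≡-Reasoning

module GeometricWeights {N : ℕ} (l : ℚ) (l<1 : l < 1ℚ) (E : ℕ → ℚ) (E>0 : ∀ t → 0ℚ < E t)
                        (E-suc : ∀ t → E (suc t) ≤ℚ l * E t) where

  open RankingProbability (λ (x : Fin N) → E (toℕ x)) (λ x → E>0 (toℕ x))

  E-antitone : ∀ {t s} → t ≤ s → E s ≤ℚ E t
  E-antitone = antitone′ ∘ ℕ.≤⇒≤′
    where
    antitone′ : ∀ {t s} → t ℕ.≤′ s → E s ≤ℚ E t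
    antitone′ ℕ.≤′-refl = ≤-refl
    antitone′ {s = suc s} (ℕ.≤′-step t≤′s) = ≤-trans (≤-trans (E-suc s) l*E≤E) (antitone′ t≤′s)
      where
      l*E≤E : l * E s ≤ℚ E s
      l*E≤E = subst (l * E s ≤ℚ_) (*-identityˡ (E s))
        (*-monoʳ-≤-nonNeg (E s) {{nonNegative (<⇒≤ (E>0 s))}} (<⇒≤ l<1))

  weight-bound : ∀ {t} L → Increasing L → All (λ y → t ≤ toℕ y) L → (1ℚ - l) * weight L < E t
  weight-bound {t} [] [] [] = subst (_< E t) (sym (*-zeroʳ (1ℚ - l))) (E>0 t)
  weight-bound {t} (y ∷ ys) (y<ys ∷ ys↑) (t≤y ∷ _) = begin-strict
    c * (e + weight ys)     ≡⟨ *-distribˡ-+ c e (weight ys) ⟩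
    c * e + c * weight ys   <⟨ +-monoʳ-< (c * e) (weight-bound ys ys↑ y<ys) ⟩
    c * e + E (suc (toℕ y)) ≤⟨ +-monoʳ-≤ (c * e) (E-suc (toℕ y)) ⟩
    c * e + l * e           ≡⟨ solve 2 (λ e l → (con 1ℚ :- l) :* e :+ l :* e := e) refl e l ⟩
    e                       ≤⟨ E-antitone t≤y ⟩
    E t                     ∎
    where
    open ≤-Reasoning
    c = 1ℚ - l
    e = E (toℕ y)

  firstProb-bound : ∀ x xs → Increasing (x ∷ xs) → 1ℚ - l < firstProb x xs
  firstProb-bound x xs x∷xs↑@(x<xs ∷ _) = *<⇒<÷₀ (weight-∷-pos x xs)
    (weight-bound (x ∷ xs) x∷xs↑ (ℕ.≤-refl ∷ All.map ℕ.<⇒≤ x<xs))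

  private
    ι-suc-scaled : ∀ n → (1ℚ - l) * ι (suc n) ≡ (1ℚ - l) + (1ℚ - l) * ι n
    ι-suc-scaled n = trans (cong ((1ℚ - l) *_) (ι-suc n))
      (trans (*-distribˡ-+ (1ℚ - l) 1ℚ (ι n)) (cong (_+ (1ℚ - l) * ι n) (*-identityʳ (1ℚ - l))))

  firstProbSum-≥ : ∀ L → Increasing L → (1ℚ - l) * ι (length L) ≤ℚ firstProbSum L
  firstProbSum-≥ [] [] = ≤-reflexive (*-zeroʳ (1ℚ - l))
  firstProbSum-≥ (x ∷ xs) x∷xs↑@(_ ∷ xs↑) =
    subst (_≤ℚ firstProbSum (x ∷ xs)) (sym (ι-suc-scaled (length xs)))
    (+-mono-≤ (<⇒≤ (firstProb-bound x xs x∷xs↑)) (firstProbSum-≥ xs xs↑))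

  firstProbSum-> : ∀ L → Increasing L → 0 ℕ.< length L → (1ℚ - l) * ι (length L) < firstProbSum L
  firstProbSum-> (x ∷ xs) x∷xs↑@(_ ∷ xs↑) _ =
    subst (_< firstProbSum (x ∷ xs)) (sym (ι-suc-scaled (length xs)))
    (+-mono-<-≤ (firstProb-bound x xs x∷xs↑) (firstProbSum-≥ xs xs↑))

¬WomanPrefers-first-choice : ∀ {N} (P : Profile N) (μ : Matching N) {m m′ v L} →
  lookup μ m ≡ just v → womanList P v ≡ m ∷ L → ¬ WomanPrefersTo P μ v m′
¬WomanPrefers-first-choice P μ {m} {L = L} μm≡v list≡ (_ , m′≻matched) =
  ¬Prefers-over-head L (subst (λ l → Prefers l _ m) list≡ (m′≻matched m μm≡v))

module Instance (n : ℕ) where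

  nextWoman : Fin (suc n) → List (Fin (suc n))
  nextWoman j with suc (toℕ j) ℕ.<? suc n
  ... | yes j+1<1+n = fromℕ< j+1<1+n ∷ []
  ... | no  _       = []

  ownWoman : Fin (suc n) → List (Fin (suc n))
  ownWoman zero    = []
  ownWoman (suc j) = suc j ∷ []

  menList : Fin (suc n) → List (Fin (suc n))
  menList j = nextWoman j ++ zero ∷ ownWoman j

  womenList : Fin (suc n) → List (Fin (suc n))
  womenList zero    = []
  womenList (suc i) = suc i ∷ inject₁ i ∷ []

  profile : Profile (suc n)
  profile = record { manList = menList ; womanList = womenList }

  ∈-nextWoman⁻ : ∀ {j v} → v ∈ nextWoman j → toℕ v ≡ suc (toℕ j)
  ∈-nextWoman⁻ {j} v∈ with suc (toℕ j) ℕ.<? suc n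
  ∈-nextWoman⁻ (here refl) | yes j+1<1+n = toℕ-fromℕ< j+1<1+n

  zero∉nextWoman : ∀ j → ¬ zero ∈ nextWoman j
  zero∉nextWoman j 0∈ with ∈-nextWoman⁻ 0∈
  ... | ()

  prefers-over-w : ∀ {j v} → Prefers (menList j) v zero → v ∈ nextWoman j
  prefers-over-w {j} = Prefers-++-∷⇒∈ (nextWoman j) (ownWoman j) (zero∉nextWoman j)

  prefers-over-own : ∀ i {v} → Prefers (menList (suc i)) v (suc i) → v ∈ nextWoman (suc i) ⊎ v ≡ zero
  prefers-over-own i {v} m≻ with ∈-++⁻ (nextWoman (suc i)) (Prefers-++-∷⇒∈ _ [] m∉next+w m≻′)
    where
    m≻′ : Prefers ((nextWoman (suc i) ++ zero ∷ []) ++ suc i ∷ []) v (suc i)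
    m≻′ = subst (λ l → Prefers l v (suc i)) (sym (++-assoc (nextWoman (suc i)) (zero ∷ []) (suc i ∷ []))) m≻
    m∉next+w : ¬ suc i ∈ nextWoman (suc i) ++ zero ∷ []
    m∉next+w m∈ with ∈-++⁻ (nextWoman (suc i)) m∈
    ... | inj₁ m∈next = ℕ.1+n≢n (sym (∈-nextWoman⁻ m∈next))
    ... | inj₂ (here ())
  ... | inj₁ v∈next       = inj₁ v∈next
  ... | inj₂ (here v≡0)   = inj₂ v≡0

  fromℕ<-≢ : ∀ {m} (m<1+n : m ℕ.< suc n) {x} → toℕ x ≢ m → fromℕ< m<1+n ≢ x
  fromℕ<-≢ m<1+n x≢m refl = x≢m (toℕ-fromℕ< m<1+n)

  menList-unique : ∀ j → Unique (menList j)
  menList-unique zero with 1 ℕ.<? suc n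
  ... | yes 1<1+n = (fromℕ<-≢ 1<1+n (λ ()) ∷ []) ∷ [] ∷ []
  ... | no  _     = [] ∷ []
  menList-unique (suc i) with suc (suc (toℕ i)) ℕ.<? suc n
  ... | yes i+2<1+n =
    (fromℕ<-≢ i+2<1+n (λ ()) ∷ fromℕ<-≢ i+2<1+n (ℕ.1+n≢n ∘ sym) ∷ []) ∷ ((λ ()) ∷ []) ∷ [] ∷ []
  ... | no  _       = ((λ ()) ∷ []) ∷ [] ∷ []

  womenList-unique : ∀ v → Unique (womenList v)
  womenList-unique zero    = []
  womenList-unique (suc i) =
    ((λ i+1≡i → ℕ.1+n≢n (trans (cong toℕ i+1≡i) (toℕ-inject₁ i))) ∷ []) ∷ [] ∷ []

  module _ (π : List (Fin (suc n))) (π↭ : π ↭ allFin (suc n)) (k : Fin (suc n)) (k-record : IsRecord π k) where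

    profileπ : Profile (suc n)
    profileπ = withList profile zero π

    ∈-womanList-suc : ∀ v {m} → toℕ v ≡ suc (toℕ m) → m ∈ womanList profileπ v
    ∈-womanList-suc (suc i) v≡m+1 =
      there (here (toℕ-injective (trans (ℕ.suc-injective (sym v≡m+1)) (sym (toℕ-inject₁ i)))))

    partner : Fin (suc n) → Fin (suc n)
    partner j with ℕ.<-cmp (toℕ j) (toℕ k)
    ... | tri< j<k _ _ = fromℕ< (ℕ.≤-<-trans j<k (toℕ<n k))
    ... | tri≈ _ _ _   = zero
    ... | tri> _ _ _   = j

    data PartnerView (j p : Fin (suc n)) : Set where
      before : toℕ j ℕ.< toℕ k → nextWoman j ≡ p ∷ [] → toℕ p ≡ suc (toℕ j) → PartnerView j p
      at     : j ≡ k → p ≡ zero → PartnerView j p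
      after  : toℕ k ℕ.< toℕ j → p ≡ j → PartnerView j p

    partnerView : ∀ j → PartnerView j (partner j)
    partnerView j with ℕ.<-cmp (toℕ j) (toℕ k)
    ... | tri< j<k _ _ = before j<k nextWoman≡ (toℕ-fromℕ< j+1<1+n)
      where
      j+1<1+n = ℕ.≤-<-trans j<k (toℕ<n k)
      nextWoman≡ : nextWoman j ≡ fromℕ< j+1<1+n ∷ []
      nextWoman≡ with suc (toℕ j) ℕ.<? suc n
      ... | yes _        = refl
      ... | no  j+1≮1+n  = contradiction j+1<1+n j+1≮1+n
    ... | tri≈ _ j≡k _ = at (toℕ-injective j≡k) refl
    ... | tri> _ _ k<j = after k<j refl

    husbandIndex : ℕ → ℕ
    husbandIndex zero = toℕ k
    husbandIndex (suc i) with i ℕ.<? toℕ k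
    ... | yes _ = i
    ... | no  _ = suc i

    husbandIndex-partner : ∀ j → husbandIndex (toℕ (partner j)) ≡ toℕ j
    husbandIndex-partner j with partnerView j
    ... | before j<k _ partner≡j+1 rewrite partner≡j+1 with toℕ j ℕ.<? toℕ k
    ...   | yes _   = refl
    ...   | no  j≮k = contradiction j<k j≮k
    husbandIndex-partner j | at refl partner≡0 rewrite partner≡0 = refl
    husbandIndex-partner j | after k<j partner≡j rewrite partner≡j = fixed (toℕ j) k<j
      where
      fixed : ∀ i → toℕ k ℕ.< i → husbandIndex i ≡ i
      fixed (suc i) k<1+i with i ℕ.<? toℕ k
      ... | yes i<k = contradiction i<k (ℕ.≤⇒≯ (ℕ.s≤s⁻¹ k<1+i))
      ... | no  _   = refl

    μ : Matching (suc n)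
    μ = Vec.tabulate (λ j → just (partner j))

    μ-lookup : ∀ j → lookup μ j ≡ just (partner j)
    μ-lookup = lookup∘tabulate (λ j → just (partner j))

    partner-after : ∀ v → toℕ k ℕ.< toℕ v → partner v ≡ v
    partner-after v k<v with partnerView v
    ... | before v<k _ _ = contradiction (ℕ.<-trans k<v v<k) (ℕ.<-irrefl refl)
    ... | at refl _      = contradiction k<v (ℕ.<-irrefl refl)
    ... | after _ p≡v    = p≡v

    isMatching : IsMatching profileπ μ
    isMatching m m′ v μm≡v μm′≡v = toℕ-injective (begin
      toℕ m                        ≡⟨ husbandIndex-partner m ⟨
      husbandIndex (toℕ (partner m))  ≡⟨ cong (husbandIndex ∘ toℕ) partner-m≡partner-m′ ⟩
      husbandIndex (toℕ (partner m′)) ≡⟨ husbandIndex-partner m′ ⟩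
      toℕ m′                       ∎)
      where
      open ≡-Reasoning
      partner-m≡partner-m′ =
        just-injective (trans (sym (μ-lookup m)) (trans μm≡v (trans (sym μm′≡v) (μ-lookup m′))))

    individuallyRational : IndividuallyRational profileπ μ
    individuallyRational m v μm≡v with trans (sym (μ-lookup m)) μm≡v | partnerView m
    ... | refl | before _ next≡ partner≡m+1 =
      subst (λ l → partner m ∈ l ++ zero ∷ ownWoman m) (sym next≡) (here refl) ,
      ∈-womanList-suc (partner m) partner≡m+1
    ... | refl | at refl partner≡0 rewrite partner≡0 =
      ∈-++⁺ʳ (nextWoman m) (here refl) , ∈-resp-↭ (↭-sym π↭) (∈-allFin m)
    ... | refl | after k<m partner≡m rewrite partner≡m with m
    ...   | suc i = ∈-++⁺ʳ (nextWoman (suc i)) (there (here refl)) , here refl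
    ...   | zero  = contradiction k<m (λ ())

    partner-k : partner k ≡ zero
    partner-k with partnerView k
    ... | before k<k _ _ = contradiction k<k (ℕ.<-irrefl refl)
    ... | at _ p≡0       = p≡0
    ... | after k<k _    = contradiction k<k (ℕ.<-irrefl refl)

    ¬WomanPrefers-after-k : ∀ v {m} → toℕ k ℕ.< toℕ v → ¬ WomanPrefersTo profileπ μ v m
    ¬WomanPrefers-after-k (suc i) k<v =
      ¬WomanPrefers-first-choice profileπ μ (trans (μ-lookup (suc i)) (cong just (partner-after (suc i) k<v))) refl

    ¬WomanPrefers-next : ∀ {j v m} → toℕ k ≤ toℕ j → v ∈ nextWoman j → ¬ WomanPrefersTo profileπ μ v m
    ¬WomanPrefers-next {v = v} k≤j v∈next =
      ¬WomanPrefers-after-k v (subst (toℕ k ℕ.<_) (sym (∈-nextWoman⁻ v∈next)) (s≤s k≤j))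

    w-prefers⇒before-k : ∀ {m} → WomanPrefersTo profileπ μ zero m → toℕ m ℕ.< toℕ k
    w-prefers⇒before-k (_ , m≻matched) =
      Prefers-record⇒< k-record (m≻matched k (trans (μ-lookup k) (cong just partner-k)))

    unblocked : ∀ m v → ¬ BlockingPair profileπ μ m v
    unblocked m v (m≻ , v≻) rewrite μ-lookup m with partnerView m
    ... | before _ next≡ _ =
      ¬Prefers-over-head (zero ∷ ownWoman m)
        (subst (λ l → Prefers (l ++ zero ∷ ownWoman m) v (partner m)) next≡ m≻)
    ... | at refl p≡0 rewrite p≡0 = ¬WomanPrefers-next ℕ.≤-refl (prefers-over-w m≻) v≻
    ... | after k<m p≡m rewrite p≡m with m | k<m | m≻
    ...   | suc i | k<1+i | m≻′ with prefers-over-own i m≻′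
    ...     | inj₁ v∈next = ¬WomanPrefers-next (ℕ.<⇒≤ k<1+i) v∈next v≻
    ...     | inj₂ refl   = ℕ.<-asym k<1+i (w-prefers⇒before-k v≻)

    record⇒stableHusband : StableHusband profileπ zero k
    record⇒stableHusband =
      μ , (isMatching , individuallyRational , unblocked) , trans (μ-lookup k) (cong just partner-k)

  #records≤numStableHusbands : ∀ {π} → π ∈ permutations (allFin (suc n)) →
    #records π ≤ numStableHusbands (withList profile zero π) zero
  #records≤numStableHusbands {π} π∈ = begin
    length (records 0 π)                  ≡⟨ cong length (filter-all SH? records-SH) ⟨
    length (filter SH? (records 0 π))     ≤⟨ length-mono-≤ (filter⁺ SH? SH? (λ { refl → id }) (records-⊆ 0 π)) ⟩
    length (filter SH? π)                 ≡⟨ ↭-length (filter-↭ SH? π↭) ⟩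
    length (filter SH? (allFin (suc n)))  ∎
    where
    open ℕ.≤-Reasoning
    SH? = stableHusband? (withList profile zero π) zero
    π↭ = permutations-↭ (allFin (suc n)) π∈
    records-SH : All (StableHusband (withList profile zero π) zero) (records 0 π)
    records-SH = All.tabulate (λ k∈ → record⇒stableHusband π π↭ _ (proj₂ (∈-records⇒IsRecord π k∈)))

module Popularity (n : ℕ) (lam : ℚ) (lam>0 : 0ℚ < lam) where

  ^ℚ-pos : ∀ t → 0ℚ < lam ^ℚ t
  ^ℚ-pos zero    = positive⁻¹ 1ℚ
  ^ℚ-pos (suc t) =
    positive⁻¹ (lam * lam ^ℚ t) {{pos*pos⇒pos lam {{positive lam>0}} (lam ^ℚ t) {{positive (^ℚ-pos t)}}}}

  Z : ℚ
  Z = sumℚ (map (λ (j : Fin (suc n)) → lam ^ℚ suc (toℕ j)) (allFin (suc n)))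

  Z>0 : 0ℚ < Z
  Z>0 = subst (_< Z) (+-identityʳ 0ℚ)
    (+-mono-<-≤ (^ℚ-pos 1)
      (sumℚ-nonNeg (Data.List.tabulate {n = n} suc) (λ j → <⇒≤ (^ℚ-pos (suc (toℕ j))))))

  E : ℕ → ℚ
  E t = (lam ^ℚ suc t) ÷₀ Z

  E>0 : ∀ t → 0ℚ < E t
  E>0 t = ÷₀-pos Z>0 (^ℚ-pos (suc t))

  E-suc : ∀ t → E (suc t) ≤ℚ lam * E t
  E-suc t = ≤-reflexive (÷₀-*ˡ Z>0 lam (lam ^ℚ suc t))

allFin-increasing : ∀ n → Increasing (allFin n)
allFin-increasing n = AllPairs.tabulate⁺-< id

lemma13 : (N : ℕ) → 1 ≤ N → (lam : ℚ) → 0ℚ < lam → lam < 1ℚ →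
    Σ (Profile N) (λ P → Σ (Fin N) (λ w →
      (∀ m → Unique (manList P m)) × (∀ v → Unique (womanList P v)) ×
      ((1ℚ - lam) * (+ N / 1) < expectedStableHusbands P w (popularity N lam))))
lemma13 (suc n) _ lam lam>0 lam<1 = profile , zero , menList-unique , womenList-unique , (begin-strict
  (1ℚ - lam) * ι (suc n)
    ≡⟨ cong (λ m → (1ℚ - lam) * ι m) (length-tabulate {n = suc n} id) ⟨
  (1ℚ - lam) * ι (length (allFin (suc n)))
    <⟨ firstProbSum-> (allFin (suc n)) (allFin-increasing (suc n)) (s≤s z≤n) ⟩
  firstProbSum (allFin (suc n))
    ≡⟨ expected-#records (allFin (suc n)) (allFin-increasing (suc n)) ⟨
  sumℚ (map (λ π → prob π * ι (#records π)) (permutations (allFin (suc n))))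
    ≤⟨ sumℚ-mono-≤ (permutations (allFin (suc n))) (λ π π∈ →
         *-monoˡ-≤-nonNeg (prob π) {{nonNegative (prob-nonNeg π)}}
           (ι-mono-≤ (#records≤numStableHusbands π∈))) ⟩
  expectedStableHusbands profile zero (popularity (suc n) lam) ∎)
  where
  open Instance n
  open Popularity n lam lam>0
  open GeometricWeights {suc n} lam lam<1 E E>0 E-suc
  open RankingProbability (popularity (suc n) lam) (λ x → E>0 (toℕ x))
  open ≤-Reasoning
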